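{- Let $h$ be an invertible $\mathbb{F}_q$-linear map from $\mathbb{F}_{q^n}$ to itself, and let $T$ be a nonzero tensor in $V^\vee\otimes V^\vee\otimes\mathbb{F}_{q^n}$. Then $M_{T^{(1,1,h)}}$ lies in $\overline{C}_3(T)$, and $C_3(T^{(1,1,h)})=C_3(T)$.
   Context: Let $q$ be a prime power, $n\ge1$, $V=\mathbb{F}_{q^n}$ as an $n$-dimensional $\mathbb{F}_q$-space, $\mathrm{Tr}$ the trace to $\mathbb{F}_q$, $V^\vee$ identified with $\mathbb{F}_{q^n}$ via $a\mapsto\hat a$, $\hat a(x)=\mathrm{Tr}(ax)$, and $\phi_c(x)=(x,x^q,\dots,x^{q^{n-1}})$. The cyclic model is the $\mathbb{F}_q$-linear isomorphism $\Phi_c:V^\vee\otimes V^\vee\otimes\mathbb{F}_{q^n}\to M_n(\mathbb{F}_{q^n})$, $\Phi_c(\sum_i\hat a_i\otimes\hat b_i\otimes c_i)=\sum_i c_i\phi_c(a_i)^T\phi_c(b_i)$, and $M_T:=\Phi_c(T)$. The action of $(1,1,h)$ is given on pure tensors by $(\hat a\otimes\hat b\otimes c)^{(1,1,h)}=\hat a\otimes\hat b\otimes h(c)$, extended linearly. Index matrix entries by $0,\dots,n-1$ and let $(M^\sigma)_{i,j}=m_{i-1,j-1}^q$ (indices mod $n$). $\overline{C}_3(T)$ denotes the $\mathbb{F}_{q^n}$-span of $M_T,M_T^\sigma,\dots,M_T^{\sigma^{n-1}}$. For $z\in\mathbb{F}_{q^n}$, $z^\vee(\hat a\otimes\hat b\otimes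 c)=\mathrm{Tr}(zc)\,\hat a\otimes\hat b$ (extended linearly), with $\hat a\otimes\hat b$ identified with $\phi_c(a)^T\phi_c(b)$; $C_3(T)=\{z^\vee(T):z\in\mathbb{F}_{q^n}\}$. -}

module Defs where

open import Level using (0ℓ)
open import Algebra.Bundles using (CommutativeRing)
open import Data.Nat as ℕ using (ℕ; zero; suc; _≤_)
open import Data.Nat.Primality using (Prime)
open import Data.Fin using (Fin; zero; suc; fromℕ; inject₁)
open import Data.List using (List; []; _∷_; map)
open import Data.Product using (Σ; ∃; _×_; _,_)
open import Relation.Nullary using (¬_)
open import Relation.Binary.PropositionalEquality using (_≡_)

IsPrimePower : ℕ → Set
IsPrimePower q = Σ ℕ λ p → Σ ℕ λ k → Prime p × (1 ≤ k) × (q ≡ p ℕ.^ k)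

record IsFiniteField (R : CommutativeRing 0ℓ 0ℓ) (N : ℕ) : Set where
  open CommutativeRing R
  field
    one≉zero : ¬ (1# ≈ 0#)
    inverse  : ∀ x → ¬ (x ≈ 0#) → Σ Carrier λ y → x * y ≈ 1#
    enum     : Fin N → Carrier
    enum-inj : ∀ i j → enum i ≈ enum j → i ≡ j
    enum-surj : ∀ x → Σ (Fin N) λ i → enum i ≈ x

module Model (R : CommutativeRing 0ℓ 0ℓ) (q m : ℕ) where
  open CommutativeRing R public using (Carrier; _≈_; _+_; _*_; 0#; 1#)

  n : ℕ
  n = suc m

  pow : Carrier → ℕ → Carrier
  pow x zero    = 1#
  pow x (suc k) = x * pow x k

  sumF : ∀ {k} → (Fin k → Carrier) → Carrier
  sumF {zero}  f = 0#
  sumF {suc k} f = f zero + sumF (λ i → f (suc i))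

  sumL : ∀ {A : Set} → (A → Carrier) → List A → Carrier
  sumL f []       = 0#
  sumL f (x ∷ xs) = f x + sumL f xs

  frobPow : ℕ → Carrier → Carrier
  frobPow i x = pow x (q ℕ.^ i)

  InFq : Carrier → Set
  InFq λ' = pow λ' q ≈ λ'

  Tr : Carrier → Carrier
  Tr x = sumF {n} (λ i → frobPow (Data.Fin.toℕ i) x)

  φc : Carrier → Fin n → Carrier
  φc x i = frobPow (Data.Fin.toℕ i) x

  Matrix : Set
  Matrix = Fin n → Fin n → Carrier

  outer : Carrier → Carrier → Matrix
  outer a b i j = φc a i * φc b j

  -- A tensor in V^∨ ⊗ V^∨ ⊗ F_{q^n}, written as a formal sum
  -- Σ_t  â_t ⊗ b̂_t ⊗ c_t  of pure tensors (every tensor is such a sum).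
  Tensor : Set
  Tensor = List (Carrier × Carrier × Carrier)

  M : Tensor → Matrix
  M T i j = sumL (λ { (a , b , c) → c * outer a b i j }) T

  -- T ≠ 0  (Φ_c is an isomorphism, so T ≠ 0 iff M_T ≠ 0)
  NonZero : Tensor → Set
  NonZero T = ¬ (∀ i j → M T i j ≈ 0#)

  act : (Carrier → Carrier) → Tensor → Tensor
  act h = map (λ { (a , b , c) → (a , b , h c) })

  predMod : Fin n → Fin n
  predMod zero    = fromℕ m
  predMod (suc i) = inject₁ i

  σ : Matrix → Matrix
  σ A i j = pow (A (predMod i) (predMod j)) q

  σ^ : ℕ → Matrix → Matrix
  σ^ zero    A = A
  σ^ (suc k) A = σ (σ^ k A)

  InC3bar : Tensor → Matrix → Set
  InC3bar T A = Σ (Fin n → Carrier) λ λs →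
    ∀ i j → A i j ≈ sumF {n} (λ k → λs k * σ^ (Data.Fin.toℕ k) (M T) i j)

  zdual : Carrier → Tensor → Matrix
  zdual z T i j = sumL (λ { (a , b , c) → Tr (z * c) * outer a b i j }) T

  SameC3 : Tensor → Tensor → Set
  SameC3 T T' =
    (∀ z → Σ Carrier λ z' → ∀ i j → zdual z T i j ≈ zdual z' T' i j) ×
    (∀ z' → Σ Carrier λ z → ∀ i j → zdual z' T' i j ≈ zdual z T i j)

  record IsInvFqLinear (h : Carrier → Carrier) : Set where
    field
      cong-h  : ∀ {x y} → x ≈ y → h x ≈ h y
      additive : ∀ x y → h (x + y) ≈ h x + h y
      homog   : ∀ c x → InFq c → h (c * x) ≈ c * h x
      inv     : Carrier → Carrier
      inv-l   : ∀ x → inv (h x) ≈ x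
      inv-r   : ∀ x → h (inv x) ≈ x

module Submission where

-- Every F_q-linear map ℓ of F_{q^n} is a linearised polynomial ℓ c = Σ_t λ_t c^(q^t).  Writing
-- a⁻¹ := a^(N-2) (so 0⁻¹ = 0), the power sums Σ_a a^(q^t) a⁻¹ equal -1 for t = 0 and vanish for
-- 0 < t < n (substitute a ↦ g a for a g with g^(q^t) ≠ g, which exists because x^(q^t) - x has fewer
-- than N roots).  Expanding Tr(a c) = Σ_t (a c)^(q^t) then gives the reproducing formula
-- ℓ c = - Σ_a Tr(a c) ℓ(a⁻¹), which yields both the λ_t and, for F_q-valued ℓ, a z with ℓ = Tr(z ·).
-- Since σ^t raises the third components of M_T to the power q^t, M_{T^(1,1,h)} = Σ_t λ_t σ^t(M_T)
-- with λ_t the coefficients of h.  Finally z^∨(T^(1,1,h)) = z′^∨(T) whenever Tr(z′ ·) = Tr(z h(·)),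
-- and such z′ (resp. z, using h⁻¹) always exist.

open import Defs
open import Level using (0ℓ)
open import Algebra.Bundles using (CommutativeRing; CommutativeMonoid)
open import Data.Nat as ℕ using (ℕ; zero; suc; _∸_; _^_; _≤_; _<_; z≤n; s≤s; _!)
import Data.Nat.Properties as ℕP
open import Data.Nat.Divisibility using (_∣_; divides; ∣1⇒≡1; ∣⇒≤; m∣m*n)
open import Data.Nat.DivMod using (m/n*n≡m)
open import Data.Nat.Primality using (Prime; euclidsLemma; prime⇒nonTrivial; prime⇒nonZero)
open import Data.Nat.Combinatorics using (_C_; nCk≡n!/k![n-k]!; k![n∸k]!∣n!; nCn≡1)
open import Data.Fin using (Fin; zero; suc; toℕ; fromℕ; inject₁; punchIn; punchOut)
open import Data.List using (List; []; _∷_; map)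
open import Data.Vec using (Vec; []; _∷_; replicate)
import Data.Fin.Properties as FinP
open import Data.Product using (Σ; ∃; _×_; _,_; proj₁; proj₂)
open import Data.Sum using (inj₁; inj₂)
open import Data.Empty using (⊥-elim)
open import Function using (_∘_)
open import Function.Definitions using (Injective)
open import Relation.Nullary using (¬_; Dec; yes; no)
open import Relation.Binary.PropositionalEquality as ≡ using (_≡_)

prime>1 : ∀ {p} → Prime p → 1 < p
prime>1 {p} pr = ℕ.nonTrivial⇒n>1 p {{prime⇒nonTrivial pr}}

prime∤! : ∀ {p} → Prime p → ∀ j → j < p → ¬ p ∣ j !
prime∤! pr zero    _   p∣1 = ℕP.<-irrefl (≡.sym (∣1⇒≡1 p∣1)) (prime>1 pr)
prime∤! pr (suc j) j<p p∣j! with euclidsLemma (suc j) (j !) pr p∣j!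
... | inj₁ p∣1+j = ℕP.<-irrefl ≡.refl (ℕP.≤-<-trans (∣⇒≤ p∣1+j) j<p)
... | inj₂ p∣j!  = prime∤! pr j (ℕP.<-trans (ℕP.n<1+n j) j<p) p∣j!

n∣n! : ∀ n → .{{ℕ.NonZero n}} → n ∣ n !
n∣n! (suc n) = m∣m*n (n !)

-- p C k · k! (p-k)! = p! is divisible by p, while neither factorial is.
prime∣C : ∀ {p} → Prime p → ∀ k → 0 < k → k < p → p ∣ p C k
prime∣C {p} pr k 0<k k<p
  with euclidsLemma (p C k) (k ! ℕ.* (p ∸ k) !) pr p∣product
  where
  instance _ = ℕP._!*_!≢0 k (p ∸ k)
  product≡p! : (p C k) ℕ.* (k ! ℕ.* (p ∸ k) !) ≡ p !
  product≡p! = ≡.trans (≡.cong (ℕ._* (k ! ℕ.* (p ∸ k) !)) (nCk≡n!/k![n-k]! (ℕP.<⇒≤ k<p)))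
                       (m/n*n≡m (k![n∸k]!∣n! (ℕP.<⇒≤ k<p)))
  p∣product : p ∣ (p C k) ℕ.* (k ! ℕ.* (p ∸ k) !)
  p∣product = ≡.subst (p ∣_) (≡.sym product≡p!) (n∣n! p {{prime⇒nonZero pr}})
... | inj₁ p∣C = p∣C
... | inj₂ p∣factorials with euclidsLemma (k !) ((p ∸ k) !) pr p∣factorials
...   | inj₁ p∣k! = ⊥-elim (prime∤! pr k k<p p∣k!)
...   | inj₂ p∣[p-k]! = ⊥-elim (prime∤! pr (p ∸ k) (ℕP.∸-monoʳ-< 0<k (ℕP.<⇒≤ k<p)) p∣[p-k]!)

-- Pigeonhole: an injection missing y would inject Fin (suc K) into Fin K.
injective⇒surjective : ∀ {K} (f : Fin K → Fin K) → Injective _≡_ _≡_ f → ∀ y → ∃ λ x → f x ≡ y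
injective⇒surjective {suc K} f f-inj y with FinP.any? (λ x → f x FinP.≟ y)
... | yes hit = hit
... | no miss = ⊥-elim (ℕP.<-irrefl ≡.refl (FinP.injective⇒≤ f∖y-injective))
  where
  y≢f : ∀ x → ¬ y ≡ f x
  y≢f x y≡fx = miss (x , ≡.sym y≡fx)
  f∖y : Fin (suc K) → Fin K
  f∖y x = punchOut (y≢f x)
  f∖y-injective : Injective _≡_ _≡_ f∖y
  f∖y-injective {a} {b} = f-inj ∘ FinP.punchOut-injective (y≢f a) (y≢f b)

module CommutativeMonoidSum (M : CommutativeMonoid 0ℓ 0ℓ) where
  open CommutativeMonoid M
  open import Algebra.Properties.CommutativeMonoid.Sum M using (sum; sum-remove; sum-cong-≋; sum-replicate-zero; sum-permute)
  open import Data.Fin.Permutation using (permutation)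
  open import Relation.Binary.Reasoning.Setoid setoid

  sum-onePoint : ∀ {k} (f : Fin k → Carrier) i → (∀ j → ¬ j ≡ i → f j ≈ ε) → sum f ≈ f i
  sum-onePoint {suc k} f i others≈ε = begin
    sum f                          ≈⟨ sum-remove f ⟩
    f i ∙ sum (f ∘ punchIn i)      ≈⟨ ∙-congˡ (sum-cong-≋ (λ j → others≈ε _ (FinP.punchInᵢ≢i i j))) ⟩
    f i ∙ sum {k} (λ _ → ε)        ≈⟨ ∙-congˡ (sum-replicate-zero k) ⟩
    f i ∙ ε                        ≈⟨ identityʳ (f i) ⟩
    f i                            ∎

  sum-reindex : ∀ {k} (f : Fin k → Carrier) (π π⁻¹ : Fin k → Fin k) →
    (∀ i → π (π⁻¹ i) ≡ i) → (∀ i → π⁻¹ (π i) ≡ i) → sum f ≈ sum (f ∘ π)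
  sum-reindex f π π⁻¹ ππ⁻¹ π⁻¹π = sum-permute f (permutation π π⁻¹ ππ⁻¹ π⁻¹π)

module RingLemmas (R : CommutativeRing 0ℓ 0ℓ) (q m : ℕ) where
  open Model R q m
  open CommutativeRing R hiding (Carrier; _≈_; _+_; _*_; 0#; 1#; zero)
  import Algebra.Properties.Semiring.Exp semiring as Exp
  open Exp using (^-congˡ; ^-assocʳ)
  open import Algebra.Properties.CommutativeSemiring.Exp commutativeSemiring using (^-distrib-*)
  open import Algebra.Properties.CommutativeSemiring.Binomial commutativeSemiring
    using (theorem; binomialTerm)
  open import Algebra.Properties.Semiring.Sum semiring
    using ( sum; sum-cong-≋; sum-init-last; sum-replicate; sum-replicate-zero
          ; ∑-distrib-+; ∑-comm; *-distribˡ-sum; *-distribʳ-sum)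
  open import Algebra.Properties.Semiring.Mult semiring
    using (×-congʳ; ×-assoc-*; ×1-homo-*) renaming (_×_ to _·_)
  open import Relation.Binary.Reasoning.Setoid setoid
  open import Algebra.Solver.Ring.NaturalCoefficients.Default commutativeSemiring using (solve; _:+_; _:*_; _:=_; con)

  pow≡^ : ∀ x k → pow x k ≡ x Exp.^ k
  pow≡^ x zero    = ≡.refl
  pow≡^ x (suc k) = ≡.cong (x *_) (pow≡^ x k)

  pow-cong : ∀ {x y} k → x ≈ y → pow x k ≈ pow y k
  pow-cong {x} {y} k x≈y rewrite pow≡^ x k | pow≡^ y k = ^-congˡ k x≈y

  pow-assocʳ : ∀ x a b → pow (pow x a) b ≈ pow x (a ℕ.* b)
  pow-assocʳ x a b rewrite pow≡^ x a | pow≡^ (x Exp.^ a) b | pow≡^ x (a ℕ.* b) = ^-assocʳ x a b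

  pow-distrib-* : ∀ x y k → pow (x * y) k ≈ pow x k * pow y k
  pow-distrib-* x y k rewrite pow≡^ (x * y) k | pow≡^ x k | pow≡^ y k = ^-distrib-* x y k

  frobPow-suc : ∀ i x → pow (frobPow i x) q ≈ frobPow (suc i) x
  frobPow-suc i x = trans (pow-assocʳ x (q ℕ.^ i) q) (reflexive (≡.cong (pow x) (ℕP.*-comm (q ℕ.^ i) q)))

  frobPow-distrib-* : ∀ i x y → frobPow i (x * y) ≈ frobPow i x * frobPow i y
  frobPow-distrib-* i x y = pow-distrib-* x y (q ℕ.^ i)

  sumF≡sum : ∀ {k} (f : Fin k → Carrier) → sumF f ≡ sum f
  sumF≡sum {zero}  f = ≡.refl
  sumF≡sum {suc k} f = ≡.cong (f zero +_) (sumF≡sum (f ∘ suc))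

  sumF-cong : ∀ {k} {f g : Fin k → Carrier} → (∀ i → f i ≈ g i) → sumF f ≈ sumF g
  sumF-cong {f = f} {g} f≈g rewrite sumF≡sum f | sumF≡sum g = sum-cong-≋ f≈g

  sumF-distrib-+ : ∀ {k} (f g : Fin k → Carrier) → sumF (λ i → f i + g i) ≈ sumF f + sumF g
  sumF-distrib-+ f g rewrite sumF≡sum (λ i → f i + g i) | sumF≡sum f | sumF≡sum g = ∑-distrib-+ f g

  *-distribˡ-sumF : ∀ {k} c (f : Fin k → Carrier) → c * sumF f ≈ sumF (λ i → c * f i)
  *-distribˡ-sumF c f rewrite sumF≡sum f | sumF≡sum (λ i → c * f i) = *-distribˡ-sum c f

  *-distribʳ-sumF : ∀ {k} c (f : Fin k → Carrier) → sumF f * c ≈ sumF (λ i → f i * c)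
  *-distribʳ-sumF c f rewrite sumF≡sum f | sumF≡sum (λ i → f i * c) = *-distribʳ-sum c f

  sumF-const : ∀ k c → sumF {k} (λ _ → c) ≈ k · c
  sumF-const k c rewrite sumF≡sum {k} (λ _ → c) = sum-replicate k

  sumF-zero : ∀ {k} (f : Fin k → Carrier) → (∀ i → f i ≈ 0#) → sumF f ≈ 0#
  sumF-zero {k} f f≈0 = trans (sumF-cong f≈0) (trans (reflexive (sumF≡sum {k} _)) (sum-replicate-zero k))

  sumF-comm : ∀ {a b} (f : Fin a → Fin b → Carrier) →
    sumF (λ i → sumF (λ j → f i j)) ≈ sumF (λ j → sumF (λ i → f i j))
  sumF-comm f = begin
    sumF (λ i → sumF (f i))           ≈⟨ sumF-cong (λ i → reflexive (sumF≡sum (f i))) ⟩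
    sumF (λ i → sum (f i))            ≡⟨ sumF≡sum (λ i → sum (f i)) ⟩
    sum (λ i → sum (f i))             ≈⟨ ∑-comm f ⟩
    sum (λ j → sum (λ i → f i j))     ≡⟨ sumF≡sum (λ j → sum (λ i → f i j)) ⟨
    sumF (λ j → sum (λ i → f i j))    ≈⟨ sumF-cong (λ j → reflexive (sumF≡sum (λ i → f i j))) ⟨
    sumF (λ j → sumF (λ i → f i j))   ∎

  sumF-head : ∀ {k} (f : Fin (suc k) → Carrier) → (∀ i → f (suc i) ≈ 0#) → sumF f ≈ f zero
  sumF-head f tail≈0 = trans (+-congˡ (sumF-zero _ tail≈0)) (+-identityʳ _)

  sumL-cong : ∀ {A : Set} {f g : A → Carrier} (T : List A) → (∀ t → f t ≈ g t) → sumL f T ≈ sumL g T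
  sumL-cong []      f≈g = refl
  sumL-cong (t ∷ T) f≈g = +-cong (f≈g t) (sumL-cong T f≈g)

  *-distribˡ-sumL : ∀ {A : Set} c (f : A → Carrier) (T : List A) → c * sumL f T ≈ sumL (λ t → c * f t) T
  *-distribˡ-sumL c f []      = zeroʳ c
  *-distribˡ-sumL c f (t ∷ T) = trans (distribˡ c _ _) (+-congˡ (*-distribˡ-sumL c f T))

  sumL-sumF : ∀ {A : Set} {k} (f : A → Fin k → Carrier) (T : List A) →
    sumL (λ t → sumF (f t)) T ≈ sumF (λ i → sumL (λ t → f t i) T)
  sumL-sumF {k = k} f [] = sym (sumF-zero {k} (λ _ → 0#) (λ _ → refl))
  sumL-sumF f (t ∷ T)    = trans (+-congˡ (sumL-sumF f T)) (sym (sumF-distrib-+ (f t) _))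

  sumL-map : ∀ {A B : Set} (f : B → Carrier) (g : A → B) (T : List A) → sumL f (map g T) ≡ sumL (f ∘ g) T
  sumL-map f g []      = ≡.refl
  sumL-map f g (t ∷ T) = ≡.cong (f (g t) +_) (sumL-map f g T)

  ∣⇒·≈0 : ∀ {p} → p · 1# ≈ 0# → ∀ {c} → p ∣ c → ∀ z → c · z ≈ 0#
  ∣⇒·≈0 {p} p·1≈0 {c} (divides d c≡dp) z = begin
    c · z                       ≈⟨ ×-congʳ c (*-identityˡ z) ⟨
    c · (1# * z)                ≈⟨ ×-assoc-* c 1# z ⟨
    (c · 1#) * z                ≈⟨ *-congʳ (reflexive (≡.cong (_· 1#) c≡dp)) ⟩
    ((d ℕ.* p) · 1#) * z        ≈⟨ *-congʳ (×1-homo-* d p) ⟩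
    ((d · 1#) * (p · 1#)) * z   ≈⟨ *-congʳ (*-congˡ p·1≈0) ⟩
    ((d · 1#) * 0#) * z         ≈⟨ *-congʳ (zeroʳ _) ⟩
    0# * z                      ≈⟨ zeroˡ z ⟩
    0#                          ∎

  PowAdditive : ℕ → Set
  PowAdditive a = ∀ x y → pow (x + y) a ≈ pow x a + pow y a

  -- In the binomial expansion of (x + y)^p all middle coefficients are multiples of p.
  frobenius-additive : ∀ {p} → Prime p → p · 1# ≈ 0# → PowAdditive p
  frobenius-additive {zero} pr _ = ⊥-elim (ℕP.<⇒≱ (prime>1 pr) z≤n)
  frobenius-additive {suc p} pr p·1≈0 x y = begin
    pow (x + y) (suc p)                             ≡⟨ pow≡^ (x + y) (suc p) ⟩
    (x + y) Exp.^ suc p                             ≈⟨ theorem (suc p) x y ⟩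
    term zero + sum (term ∘ suc)                    ≈⟨ +-congˡ (sum-init-last (term ∘ suc)) ⟩
    term zero + (sum (term ∘ suc ∘ inject₁) + term (suc (fromℕ p)))
      ≈⟨ +-cong first≈y^p (+-cong (trans (sum-cong-≋ middle≈0) (sum-replicate-zero p)) last≈x^p) ⟩
    pow y (suc p) + (0# + pow x (suc p))            ≈⟨ trans (+-congˡ (+-identityˡ _)) (+-comm _ _) ⟩
    pow x (suc p) + pow y (suc p)                   ∎
    where
    term = binomialTerm x y (suc p)
    first≈y^p : term zero ≈ pow y (suc p)
    first≈y^p = trans (+-identityʳ _) (trans (*-identityˡ _) (reflexive (≡.sym (pow≡^ y (suc p)))))
    last≈x^p : term (suc (fromℕ p)) ≈ pow x (suc p)
    last≈x^p rewrite FinP.toℕ-fromℕ p | nCn≡1 (suc p) | ℕP.n∸n≡0 (suc p) =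
      trans (+-identityʳ _) (trans (*-identityʳ _) (reflexive (≡.sym (pow≡^ x (suc p)))))
    middle≈0 : ∀ i → term (suc (inject₁ i)) ≈ 0#
    middle≈0 i = ∣⇒·≈0 p·1≈0 (prime∣C pr (suc (toℕ (inject₁ i))) (s≤s z≤n) k<p) _
      where
      k<p : suc (toℕ (inject₁ i)) < suc p
      k<p = s≤s (≡.subst (_< p) (≡.sym (FinP.toℕ-inject₁ i)) (FinP.toℕ<n i))

  pow-additive-^ : ∀ {a} → PowAdditive a → ∀ e → PowAdditive (a ℕ.^ e)
  pow-additive-^ {a} additive zero x y =
    trans (*-identityʳ _) (sym (+-cong (*-identityʳ x) (*-identityʳ y)))
  pow-additive-^ {a} additive (suc e) x y = begin
    pow (x + y) (a ℕ.* a ℕ.^ e)                        ≈⟨ pow-assocʳ (x + y) a (a ℕ.^ e) ⟨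
    pow (pow (x + y) a) (a ℕ.^ e)                      ≈⟨ pow-cong (a ℕ.^ e) (additive x y) ⟩
    pow (pow x a + pow y a) (a ℕ.^ e)                  ≈⟨ pow-additive-^ additive e (pow x a) (pow y a) ⟩
    pow (pow x a) (a ℕ.^ e) + pow (pow y a) (a ℕ.^ e)  ≈⟨ +-cong (pow-assocʳ x a (a ℕ.^ e)) (pow-assocʳ y a (a ℕ.^ e)) ⟩
    pow x (a ℕ.* a ℕ.^ e) + pow y (a ℕ.* a ℕ.^ e)      ∎

  pow-additive-sumF : ∀ {a} → PowAdditive a → 0 < a → ∀ {k} (f : Fin k → Carrier) →
    pow (sumF f) a ≈ sumF (λ i → pow (f i) a)
  pow-additive-sumF {suc a} additive _ {zero}  f = zeroˡ _
  pow-additive-sumF         additive a>0 {suc k} f =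
    trans (additive _ _) (+-congˡ (pow-additive-sumF additive a>0 (f ∘ suc)))

  pow-additive-sumL : ∀ {a} → PowAdditive a → 0 < a → ∀ {A : Set} (f : A → Carrier) (T : List A) →
    pow (sumL f T) a ≈ sumL (λ t → pow (f t) a) T
  pow-additive-sumL {suc a} additive _   f []      = zeroˡ _
  pow-additive-sumL         additive a>0 f (t ∷ T) =
    trans (additive _ _) (+-congˡ (pow-additive-sumL additive a>0 f T))

  sumF-shift : ∀ k (g : ℕ → Carrier) →
    sumF {k} (λ i → g (suc (toℕ i))) + g 0 ≈ sumF {k} (λ i → g (toℕ i)) + g k
  sumF-shift zero    g = refl
  sumF-shift (suc k) g = begin
    (g 1 + G (g ∘ ℕ.suc ∘ ℕ.suc)) + g 0   ≈⟨ +-congʳ (+-comm _ _) ⟩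
    (G (g ∘ ℕ.suc ∘ ℕ.suc) + g 1) + g 0   ≈⟨ +-congʳ (sumF-shift k (g ∘ ℕ.suc)) ⟩
    (G (g ∘ ℕ.suc) + g (suc k)) + g 0     ≈⟨ solve 3 (λ a b c → (a :+ b) :+ c := (c :+ a) :+ b) refl _ _ _ ⟩
    (g 0 + G (g ∘ ℕ.suc)) + g (suc k)     ∎
    where
    G : (ℕ → Carrier) → Carrier
    G h = sumF {k} (λ i → h (toℕ i))

  ·1-homo-^ : ∀ a e → (a ℕ.^ e) · 1# ≈ pow (a · 1#) e
  ·1-homo-^ a zero    = +-identityʳ 1#
  ·1-homo-^ a (suc e) = trans (×1-homo-* a (a ℕ.^ e)) (*-congˡ (·1-homo-^ a e))

  -- The monic polynomial x^d + c_{d-1} x^{d-1} + … + c₀, given by the vector of its lower coefficients (c₀ first).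
  evalMonic : ∀ {d} → Vec Carrier d → Carrier → Carrier
  evalMonic []       x = 1#
  evalMonic (c ∷ cs) x = c + x * evalMonic cs x

  divideMonic : ∀ {d} → Carrier → Vec Carrier (suc d) → Vec Carrier d
  divideMonic r (c ∷ [])     = []
  divideMonic r (c ∷ c₁ ∷ cs) = evalMonic (c₁ ∷ cs) r ∷ divideMonic r (c₁ ∷ cs)

  evalMonic-divide : ∀ {d} r (P : Vec Carrier (suc d)) x →
    evalMonic P x + r * evalMonic (divideMonic r P) x ≈ x * evalMonic (divideMonic r P) x + evalMonic P r
  evalMonic-divide r (c ∷ []) x =
    solve 3 (λ c x r → (c :+ x :* con 1) :+ r :* con 1 := x :* con 1 :+ (c :+ r :* con 1)) refl c x r
  evalMonic-divide r (c ∷ cs@(_ ∷ _)) x = begin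
    (c + x * A) + r * (Ar + x * B)      ≈⟨ solve 6 (λ c x A r Ar B → (c :+ x :* A) :+ r :* (Ar :+ x :* B)
                                                  := (c :+ r :* Ar) :+ x :* (A :+ r :* B)) refl c x A r Ar B ⟩
    (c + r * Ar) + x * (A + r * B)      ≈⟨ +-congˡ (*-congˡ (evalMonic-divide r cs x)) ⟩
    (c + r * Ar) + x * (x * B + Ar)     ≈⟨ solve 5 (λ c r Ar x B → (c :+ r :* Ar) :+ x :* (x :* B :+ Ar)
                                                  := x :* (Ar :+ x :* B) :+ (c :+ r :* Ar)) refl c r Ar x B ⟩
    x * (Ar + x * B) + (c + r * Ar)     ∎
    where
    A  = evalMonic cs x
    Ar = evalMonic cs r
    B  = evalMonic (divideMonic r cs) x

module FiniteFieldLemmas (R : CommutativeRing 0ℓ 0ℓ) (q m : ℕ) (F : IsFiniteField R (q ℕ.^ suc m)) where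
  open Model R q m
  open RingLemmas R q m
  open CommutativeRing R hiding (Carrier; _≈_; _+_; _*_; 0#; 1#; zero)
  open IsFiniteField F
  open import Algebra.Properties.Group +-group using (identityʳ-unique; x∙y⁻¹≈ε⇒x≈y; x≈y⇒x∙y⁻¹≈ε)
  open import Algebra.Properties.Ring ring using (x[y-z]≈xy-xz; [y-z]x≈yx-zx; -‿distribʳ-*)
  open import Algebra.Properties.CommutativeSemigroup *-commutativeSemigroup using (xy∙z≈y∙xz)
  open import Algebra.Properties.Semiring.Mult semiring using () renaming (_×_ to _·_)
  open import Algebra.Properties.Semiring.Sum semiring using (sum)
  import Algebra.Properties.CommutativeMonoid.Sum *-commutativeMonoid as Prod
  module Add = CommutativeMonoidSum +-commutativeMonoid
  module Mul = CommutativeMonoidSum *-commutativeMonoid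
  open import Relation.Nullary.Decidable using (map′)
  open import Relation.Binary.Reasoning.Setoid setoid

  N : ℕ
  N = q ℕ.^ n

  index : Carrier → Fin N
  index x = proj₁ (enum-surj x)

  enum-index : ∀ x → enum (index x) ≈ x
  enum-index x = proj₂ (enum-surj x)

  index-cong : ∀ {x y} → x ≈ y → index x ≡ index y
  index-cong {x} {y} x≈y = enum-inj _ _ (trans (enum-index x) (trans x≈y (sym (enum-index y))))

  N>0 : 0 < N
  N>0 = ℕP.≤-<-trans z≤n (FinP.toℕ<n (index 0#))

  _≈?_ : ∀ x y → Dec (x ≈ y)
  x ≈? y = map′ index≡⇒≈ index-cong (index x FinP.≟ index y)
    where
    index≡⇒≈ : index x ≡ index y → x ≈ y
    index≡⇒≈ i≡j = trans (sym (enum-index x)) (trans (reflexive (≡.cong enum i≡j)) (enum-index y))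

  x≉0∧xy≈0⇒y≈0 : ∀ {x y} → ¬ x ≈ 0# → x * y ≈ 0# → y ≈ 0#
  x≉0∧xy≈0⇒y≈0 {x} {y} x≉0 xy≈0 = begin
    y                ≈⟨ *-identityˡ y ⟨
    1# * y           ≈⟨ *-congʳ (proj₂ (inverse x x≉0)) ⟨
    (x * x⁻¹) * y    ≈⟨ xy∙z≈y∙xz x x⁻¹ y ⟩
    x⁻¹ * (x * y)    ≈⟨ *-congˡ xy≈0 ⟩
    x⁻¹ * 0#         ≈⟨ zeroʳ x⁻¹ ⟩
    0#               ∎
    where x⁻¹ = proj₁ (inverse x x≉0)

  *-≉0 : ∀ {x y} → ¬ x ≈ 0# → ¬ y ≈ 0# → ¬ x * y ≈ 0#
  *-≉0 x≉0 y≉0 = y≉0 ∘ x≉0∧xy≈0⇒y≈0 x≉0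

  *-cancelˡ-≉0 : ∀ {x y z} → ¬ x ≈ 0# → x * y ≈ x * z → y ≈ z
  *-cancelˡ-≉0 {x} {y} {z} x≉0 xy≈xz =
    x∙y⁻¹≈ε⇒x≈y y z (x≉0∧xy≈0⇒y≈0 x≉0 (trans (x[y-z]≈xy-xz x y z) (x≈y⇒x∙y⁻¹≈ε xy≈xz)))

  a≉b∧az≈bz⇒z≈0 : ∀ {a b z} → ¬ a ≈ b → a * z ≈ b * z → z ≈ 0#
  a≉b∧az≈bz⇒z≈0 {a} {b} {z} a≉b az≈bz =
    x≉0∧xy≈0⇒y≈0 (a≉b ∘ x∙y⁻¹≈ε⇒x≈y a b) (trans ([y-z]x≈yx-zx z a b) (x≈y⇒x∙y⁻¹≈ε az≈bz))

  pow≈0⇒≈0 : ∀ e x → pow x e ≈ 0# → x ≈ 0#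
  pow≈0⇒≈0 zero    x 1≈0 = ⊥-elim (one≉zero 1≈0)
  pow≈0⇒≈0 (suc e) x x^e≈0 with x ≈? 0#
  ... | yes x≈0 = x≈0
  ... | no  x≉0 = pow≈0⇒≈0 e x (x≉0∧xy≈0⇒y≈0 x≉0 x^e≈0)

  pow-zeroˡ : ∀ {k} → 0 < k → pow 0# k ≈ 0#
  pow-zeroˡ {suc k} _ = zeroˡ _

  record CarrierPermutation : Set where
    field
      to from   : Carrier → Carrier
      to-cong   : ∀ {x y} → x ≈ y → to x ≈ to y
      from-cong : ∀ {x y} → x ≈ y → from x ≈ from y
      to-from   : ∀ y → to (from y) ≈ y
      from-to   : ∀ x → from (to x) ≈ x

  sumAll : (Carrier → Carrier) → Carrier
  sumAll f = sumF {N} (f ∘ enum)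

  prodAll : (Carrier → Carrier) → Carrier
  prodAll f = Prod.sum {N} (f ∘ enum)

  module _ (π : CarrierPermutation) {f : Carrier → Carrier} (f-cong : ∀ {x y} → x ≈ y → f x ≈ f y) where
    open CarrierPermutation π

    private
      πᶠ π⁻¹ᶠ : Fin N → Fin N
      πᶠ i = index (to (enum i))
      π⁻¹ᶠ i = index (from (enum i))

      πᶠ-π⁻¹ᶠ : ∀ i → πᶠ (π⁻¹ᶠ i) ≡ i
      πᶠ-π⁻¹ᶠ i = enum-inj _ _ (trans (enum-index _) (trans (to-cong (enum-index _)) (to-from _)))

      π⁻¹ᶠ-πᶠ : ∀ i → π⁻¹ᶠ (πᶠ i) ≡ i
      π⁻¹ᶠ-πᶠ i = enum-inj _ _ (trans (enum-index _) (trans (from-cong (enum-index _)) (from-to _)))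

      f∘πᶠ : ∀ i → f (enum (πᶠ i)) ≈ f (to (enum i))
      f∘πᶠ i = f-cong (enum-index _)

    sumAll-permute : sumAll f ≈ sumAll (f ∘ to)
    sumAll-permute = begin
      sumF {N} (f ∘ enum)        ≡⟨ sumF≡sum (f ∘ enum) ⟩
      sum (f ∘ enum)             ≈⟨ Add.sum-reindex (f ∘ enum) πᶠ π⁻¹ᶠ πᶠ-π⁻¹ᶠ π⁻¹ᶠ-πᶠ ⟩
      sum (f ∘ enum ∘ πᶠ)        ≡⟨ sumF≡sum (f ∘ enum ∘ πᶠ) ⟨
      sumF {N} (f ∘ enum ∘ πᶠ)   ≈⟨ sumF-cong f∘πᶠ ⟩
      sumF {N} (f ∘ to ∘ enum)   ∎

    prodAll-permute : prodAll f ≈ prodAll (f ∘ to)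
    prodAll-permute =
      trans (Mul.sum-reindex (f ∘ enum) πᶠ π⁻¹ᶠ πᶠ-π⁻¹ᶠ π⁻¹ᶠ-πᶠ) (Prod.sum-cong-≋ f∘πᶠ)

  translation : Carrier → CarrierPermutation
  translation a = record
    { to = _+ a ; from = _- a ; to-cong = +-congʳ ; from-cong = +-congʳ
    ; to-from = λ y → trans (+-assoc y _ _) (trans (+-congˡ (-‿inverseˡ a)) (+-identityʳ y))
    ; from-to = λ x → trans (+-assoc x _ _) (trans (+-congˡ (-‿inverseʳ a)) (+-identityʳ x))
    }

  dilation : ∀ g → ¬ g ≈ 0# → CarrierPermutation
  dilation g g≉0 = record
    { to = g *_ ; from = g⁻¹ *_ ; to-cong = *-congˡ ; from-cong = *-congˡ
    ; to-from = λ y → trans (sym (*-assoc _ _ _)) (trans (*-congʳ gg⁻¹≈1) (*-identityˡ y))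
    ; from-to = λ x → trans (sym (*-assoc _ _ _)) (trans (*-congʳ (trans (*-comm _ _) gg⁻¹≈1)) (*-identityˡ x))
    }
    where
    g⁻¹ = proj₁ (inverse g g≉0)
    gg⁻¹≈1 = proj₂ (inverse g g≉0)

  -- Translation by 1 permutes the field, so ∑ x = ∑ (x + 1) = ∑ x + N · 1.
  N·1≈0 : N · 1# ≈ 0#
  N·1≈0 = identityʳ-unique S (N · 1#) (sym (begin
    S                         ≈⟨ sumAll-permute (translation 1#) (λ x≈y → x≈y) ⟩
    sumAll (_+ 1#)            ≈⟨ sumF-distrib-+ {N} enum (λ _ → 1#) ⟩
    S + sumF {N} (λ _ → 1#)   ≈⟨ +-congˡ (sumF-const N 1#) ⟩
    S + N · 1#                ∎))
    where S = sumAll (λ x → x)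

  private
    enum≉0 : ∀ j → ¬ j ≡ index 0# → ¬ enum j ≈ 0#
    enum≉0 j j≢0 enumj≈0 = j≢0 (enum-inj _ _ (trans enumj≈0 (sym (enum-index 0#))))

  module _ {f : Carrier → Carrier} (f-cong : ∀ {x y} → x ≈ y → f x ≈ f y) where

    sumAll-concentrated : (∀ a → ¬ a ≈ 0# → f a ≈ 0#) → sumAll f ≈ f 0#
    sumAll-concentrated f≈0 = begin
      sumF {N} (f ∘ enum)    ≡⟨ sumF≡sum (f ∘ enum) ⟩
      sum (f ∘ enum)         ≈⟨ Add.sum-onePoint (f ∘ enum) (index 0#) (λ j j≢0 → f≈0 _ (enum≉0 j j≢0)) ⟩
      f (enum (index 0#))    ≈⟨ f-cong (enum-index 0#) ⟩
      f 0#                   ∎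

    prodAll-concentrated : (∀ a → ¬ a ≈ 0# → f a ≈ 1#) → prodAll f ≈ f 0#
    prodAll-concentrated f≈1 =
      trans (Mul.sum-onePoint (f ∘ enum) (index 0#) (λ j j≢0 → f≈1 _ (enum≉0 j j≢0))) (f-cong (enum-index 0#))

  prodAll-*ˡ : ∀ g f → prodAll (λ a → g * f a) ≈ pow g N * prodAll f
  prodAll-*ˡ g f = begin
    prodAll (λ a → g * f a)              ≈⟨ Prod.∑-distrib-+ (λ _ → g) (f ∘ enum) ⟩
    Prod.sum {N} (λ _ → g) * prodAll f   ≈⟨ *-congʳ (Prod.sum-replicate N) ⟩
    g Exp.^ N * prodAll f                ≡⟨ ≡.cong (_* prodAll f) (pow≡^ g N) ⟨
    pow g N * prodAll f                  ∎
    where import Algebra.Properties.Semiring.Exp semiring as Exp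

  ifZero_then_else_ : Carrier → Carrier → Carrier → Carrier
  ifZero a then b else c with a ≈? 0#
  ... | yes _ = b
  ... | no  _ = c

  ifZero-cong : ∀ {a a′ c c′} b → a ≈ a′ → c ≈ c′ → ifZero a then b else c ≈ ifZero a′ then b else c′
  ifZero-cong {a} {a′} b a≈a′ c≈c′ with a ≈? 0# | a′ ≈? 0#
  ... | yes _   | yes _    = refl
  ... | yes a≈0 | no  a′≉0 = ⊥-elim (a′≉0 (trans (sym a≈a′) a≈0))
  ... | no  a≉0 | yes a′≈0 = ⊥-elim (a≉0 (trans a≈a′ a′≈0))
  ... | no  _   | no  _    = c≈c′

  ifZero-≉0 : ∀ {a} b c → ¬ a ≈ 0# → ifZero a then b else c ≈ c
  ifZero-≉0 {a} b c a≉0 with a ≈? 0#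
  ... | yes a≈0 = ⊥-elim (a≉0 a≈0)
  ... | no  _   = refl

  ifZero-≈0 : ∀ {a} b c → a ≈ 0# → ifZero a then b else c ≈ b
  ifZero-≈0 {a} b c a≈0 with a ≈? 0#
  ... | yes _   = refl
  ... | no  a≉0 = ⊥-elim (a≉0 a≈0)

  prod-≉0 : ∀ {k} (f : Fin k → Carrier) → (∀ i → ¬ f i ≈ 0#) → ¬ Prod.sum f ≈ 0#
  prod-≉0 {zero}  f f≉0 = one≉zero
  prod-≉0 {suc k} f f≉0 = *-≉0 (f≉0 zero) (prod-≉0 (f ∘ suc) (f≉0 ∘ suc))

  -- With a* := a for a ≉ 0 and 0* := 1, multiplying by g ≉ 0 permutes the a*, except that 0* picks up the factor g.
  fermat : ∀ g → pow g N ≈ g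
  fermat g with g ≈? 0#
  ... | yes g≈0 = trans (pow-cong N g≈0) (trans (pow-zeroˡ N>0) (sym g≈0))
  ... | no  g≉0 = *-cancelˡ-≉0 P≉0 (begin
    P * pow g N                                   ≈⟨ *-comm P _ ⟩
    pow g N * P                                   ≈⟨ prodAll-*ˡ g star ⟨
    prodAll (λ a → g * star a)                    ≈⟨ Prod.sum-cong-≋ (g*star ∘ enum) ⟩
    prodAll (λ a → corr a * star (g * a))         ≈⟨ Prod.∑-distrib-+ (corr ∘ enum) (λ i → star (g * enum i)) ⟩
    prodAll corr * prodAll (λ a → star (g * a))   ≈⟨ *-cong corr-product (sym (prodAll-permute (dilation g g≉0) star-cong)) ⟩
    g * P                                         ≈⟨ *-comm g P ⟩
    P * g                                         ∎)
    where
    star corr : Carrier → Carrier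
    star a = ifZero a then 1# else a
    corr a = ifZero a then g else 1#
    P = prodAll star

    star-cong : ∀ {a b} → a ≈ b → star a ≈ star b
    star-cong a≈b = ifZero-cong 1# a≈b a≈b

    P≉0 : ¬ P ≈ 0#
    P≉0 = prod-≉0 (star ∘ enum) (λ i → star≉0 (enum i))
      where
      star≉0 : ∀ a → ¬ star a ≈ 0#
      star≉0 a with a ≈? 0#
      ... | yes _   = one≉zero
      ... | no  a≉0 = a≉0

    g*star : ∀ a → g * star a ≈ corr a * star (g * a)
    g*star a with a ≈? 0#
    ... | yes a≈0 = *-congˡ (sym (ifZero-≈0 1# (g * a) (trans (*-congˡ a≈0) (zeroʳ g))))
    ... | no  a≉0 = trans (sym (*-identityˡ _)) (*-congˡ (sym (ifZero-≉0 1# (g * a) (*-≉0 g≉0 a≉0))))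

    corr-product : prodAll corr ≈ g
    corr-product = trans (prodAll-concentrated {corr} (λ a≈b → ifZero-cong g a≈b refl) (λ a → ifZero-≉0 {a} g 1#))
                         (ifZero-≈0 g 1# refl)

  monic-roots≤degree : ∀ {d} (P : Vec Carrier d) {K} (r : Fin K → Carrier) →
    (∀ i j → r i ≈ r j → i ≡ j) → (∀ i → evalMonic P (r i) ≈ 0#) → ¬ d < K
  monic-roots≤degree []       {suc K} r r-inj roots _ = one≉zero (roots zero)
  monic-roots≤degree (c ∷ cs) {suc K} r r-inj roots (s≤s d<K) =
    monic-roots≤degree (divideMonic r₀ (c ∷ cs)) (r ∘ suc) (λ i j → FinP.suc-injective ∘ r-inj _ _) quotient-roots d<K
    where
    r₀ = r zero
    quotient-roots : ∀ i → evalMonic (divideMonic r₀ (c ∷ cs)) (r (suc i)) ≈ 0#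
    quotient-roots i = a≉b∧az≈bz⇒z≈0 (λ r₀≈y → 0≢1+i (r-inj zero (suc i) r₀≈y)) (begin
      r₀ * Q y                  ≈⟨ +-identityˡ _ ⟨
      0# + r₀ * Q y             ≈⟨ +-congʳ (roots (suc i)) ⟨
      P y + r₀ * Q y            ≈⟨ evalMonic-divide r₀ (c ∷ cs) y ⟩
      y * Q y + P r₀            ≈⟨ +-congˡ (roots zero) ⟩
      y * Q y + 0#              ≈⟨ +-identityʳ _ ⟩
      y * Q y                   ∎)
      where
      y = r (suc i)
      P = evalMonic (c ∷ cs)
      Q = evalMonic (divideMonic r₀ (c ∷ cs))
      0≢1+i : ¬ zero ≡ suc i
      0≢1+i ()

  -- x^e - x is the monic polynomial with lower coefficients 0, -1, 0, …, 0, so it has at most e < N roots.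
  ∃-pow-≉ : ∀ e → 2 ≤ e → e < N → ∃ λ g → ¬ pow g e ≈ g
  ∃-pow-≉ (suc (suc e)) (s≤s (s≤s z≤n)) e<N
    with FinP.¬∀⟶∃¬ N (λ i → pow (enum i) (2 ℕ.+ e) ≈ enum i) (λ i → _ ≈? _) all-fixed⇒⊥
    where
    evalMonic-x^e-x : ∀ x → evalMonic (0# ∷ - 1# ∷ replicate e 0#) x ≈ pow x (2 ℕ.+ e) - x
    evalMonic-x^e-x x = begin
      0# + x * (- 1# + x * evalMonic (replicate e 0#) x)   ≈⟨ +-congˡ (*-congˡ (+-congˡ (*-congˡ (evalMonic-zeros e)))) ⟩
      0# + x * (- 1# + x * pow x e)                        ≈⟨ +-identityˡ _ ⟩
      x * (- 1# + x * pow x e)                             ≈⟨ distribˡ x _ _ ⟩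
      x * - 1# + x * (x * pow x e)                         ≈⟨ +-comm _ _ ⟩
      x * (x * pow x e) + x * - 1#                         ≈⟨ +-congˡ (trans (sym (-‿distribʳ-* x 1#)) (-‿cong (*-identityʳ x))) ⟩
      pow x (2 ℕ.+ e) - x                                  ∎
      where
      evalMonic-zeros : ∀ k → evalMonic (replicate k 0#) x ≈ pow x k
      evalMonic-zeros zero    = refl
      evalMonic-zeros (suc k) = trans (+-identityˡ _) (*-congˡ (evalMonic-zeros k))
    all-fixed⇒⊥ : ¬ (∀ i → pow (enum i) (2 ℕ.+ e) ≈ enum i)
    all-fixed⇒⊥ fixed = monic-roots≤degree (0# ∷ - 1# ∷ replicate e 0#) enum enum-inj
      (λ i → trans (evalMonic-x^e-x (enum i)) (x≈y⇒x∙y⁻¹≈ε (fixed i))) e<N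
  ... | i , not-fixed = enum i , not-fixed

module Galois (R : CommutativeRing 0ℓ 0ℓ) (q m : ℕ) (q-primePower : IsPrimePower q)
              (F : IsFiniteField R (q ℕ.^ suc m)) where
  open Model R q m
  open RingLemmas R q m
  open FiniteFieldLemmas R q m F
  open CommutativeRing R hiding (Carrier; _≈_; _+_; _*_; 0#; 1#; zero)
  open IsFiniteField F
  open import Algebra.Properties.Group +-group using (identityʳ-unique; ∙-cancelʳ; inverseˡ-unique; inverseʳ-unique)
  open import Algebra.Properties.Ring ring using (-‿involutive; -‿distribˡ-*; -1*x≈-x)
  open import Algebra.Properties.Semiring.Mult semiring using () renaming (_×_ to _·_)
  open import Algebra.Properties.CommutativeSemigroup *-commutativeSemigroup using (interchange; x∙yz≈y∙xz; x∙yz≈z∙yx; x∙yz≈xz∙y)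
  open import Relation.Binary.Reasoning.Setoid setoid

  private
    p = proj₁ q-primePower
    k = proj₁ (proj₂ q-primePower)
    p-prime : Prime p
    p-prime = proj₁ (proj₂ (proj₂ q-primePower))
    1≤k : 1 ≤ k
    1≤k = proj₁ (proj₂ (proj₂ (proj₂ q-primePower)))
    q≡p^k : q ≡ p ℕ.^ k
    q≡p^k = proj₂ (proj₂ (proj₂ (proj₂ q-primePower)))

  1<q : 1 < q
  1<q = ≡.subst (1 <_) (≡.sym q≡p^k) (ℕP.<-≤-trans (prime>1 p-prime) p≤p^k)
    where
    p≤p^k : p ≤ p ℕ.^ k
    p≤p^k = ≡.subst (_≤ p ℕ.^ k) (ℕP.*-identityʳ p) (ℕP.^-monoʳ-≤ p {{prime⇒nonZero p-prime}} 1≤k)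

  0<q : 0 < q
  0<q = ℕP.<-trans (s≤s z≤n) 1<q

  -- N · 1 = (p · 1)^(kn) vanishes, and a field has no nilpotents.
  p·1≈0 : p · 1# ≈ 0#
  p·1≈0 = pow≈0⇒≈0 (k ℕ.* n) (p · 1#) (begin
    pow (p · 1#) (k ℕ.* n)     ≈⟨ ·1-homo-^ p (k ℕ.* n) ⟨
    (p ℕ.^ (k ℕ.* n)) · 1#     ≡⟨ ≡.cong (_· 1#) (≡.trans (≡.cong (ℕ._^ n) q≡p^k) (ℕP.^-*-assoc p k n)) ⟨
    N · 1#                     ≈⟨ N·1≈0 ⟩
    0#                         ∎)

  frobenius-q-additive : PowAdditive q
  frobenius-q-additive =
    ≡.subst PowAdditive (≡.sym q≡p^k) (pow-additive-^ (frobenius-additive p-prime p·1≈0) k)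

  frobPow-+ : ∀ i x y → frobPow i (x + y) ≈ frobPow i x + frobPow i y
  frobPow-+ = pow-additive-^ frobenius-q-additive

  frobPow-cong : ∀ i {x y} → x ≈ y → frobPow i x ≈ frobPow i y
  frobPow-cong i = pow-cong (q ℕ.^ i)

  frobPow-n : ∀ x → frobPow n x ≈ x
  frobPow-n = fermat

  InFq-frobPow : ∀ {c} → InFq c → ∀ i → frobPow i c ≈ c
  InFq-frobPow {c} c∈Fq zero    = *-identityʳ c
  InFq-frobPow {c} c∈Fq (suc i) = begin
    pow c (q ℕ.* q ℕ.^ i)      ≈⟨ pow-assocʳ c q (q ℕ.^ i) ⟨
    pow (pow c q) (q ℕ.^ i)    ≈⟨ pow-cong (q ℕ.^ i) c∈Fq ⟩
    frobPow i c                ≈⟨ InFq-frobPow c∈Fq i ⟩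
    c                          ∎

  Tr-cong : ∀ {x y} → x ≈ y → Tr x ≈ Tr y
  Tr-cong x≈y = sumF-cong {n} (λ i → frobPow-cong (toℕ i) x≈y)

  Tr-+ : ∀ x y → Tr (x + y) ≈ Tr x + Tr y
  Tr-+ x y = trans (sumF-cong {n} (λ i → frobPow-+ (toℕ i) x y))
                   (sumF-distrib-+ {n} (λ i → frobPow (toℕ i) x) (λ i → frobPow (toℕ i) y))

  Tr-homogeneous : ∀ c x → InFq c → Tr (c * x) ≈ c * Tr x
  Tr-homogeneous c x c∈Fq = begin
    sumF {n} (λ i → frobPow (toℕ i) (c * x))
      ≈⟨ sumF-cong {n} (λ i → frobPow-distrib-* (toℕ i) c x) ⟩
    sumF {n} (λ i → frobPow (toℕ i) c * frobPow (toℕ i) x)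
      ≈⟨ sumF-cong {n} (λ i → *-congʳ {frobPow (toℕ i) x} (InFq-frobPow c∈Fq (toℕ i))) ⟩
    sumF {n} (λ i → c * frobPow (toℕ i) x)
      ≈⟨ *-distribˡ-sumF {n} c (λ i → frobPow (toℕ i) x) ⟨
    c * Tr x ∎

  -- Frobenius permutes the conjugates x, x^q, …, x^(q^(n-1)) cyclically, since x^(q^n) = x.
  Tr-InFq : ∀ x → InFq (Tr x)
  Tr-InFq x = ∙-cancelʳ x _ _ (begin
    pow (Tr x) q + x
      ≈⟨ +-congʳ (pow-additive-sumF frobenius-q-additive 0<q {n} (conj ∘ toℕ)) ⟩
    sumF {n} (λ i → pow (conj (toℕ i)) q) + x
      ≈⟨ +-cong (sumF-cong {n} (λ i → frobPow-suc (toℕ i) x)) (sym (*-identityʳ x)) ⟩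
    sumF {n} (λ i → conj (suc (toℕ i))) + conj 0
      ≈⟨ sumF-shift n conj ⟩
    Tr x + conj n
      ≈⟨ +-congˡ (frobPow-n x) ⟩
    Tr x + x ∎)
    where
    conj : ℕ → Carrier
    conj i = frobPow i x

  record IsFqLinear (ℓ : Carrier → Carrier) : Set where
    field
      cong        : ∀ {x y} → x ≈ y → ℓ x ≈ ℓ y
      additive    : ∀ x y → ℓ (x + y) ≈ ℓ x + ℓ y
      homogeneous : ∀ c x → InFq c → ℓ (c * x) ≈ c * ℓ x

    0-preserving : ℓ 0# ≈ 0#
    0-preserving = identityʳ-unique (ℓ 0#) (ℓ 0#) (trans (sym (additive 0# 0#)) (cong (+-identityˡ 0#)))

    neg-preserving : ∀ x → ℓ (- x) ≈ - ℓ x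
    neg-preserving x =
      inverseʳ-unique (ℓ x) (ℓ (- x)) (trans (sym (additive x (- x))) (trans (cong (-‿inverseʳ x)) 0-preserving))

    sumF-preserving : ∀ {j} (f : Fin j → Carrier) → ℓ (sumF f) ≈ sumF (ℓ ∘ f)
    sumF-preserving {zero}  f = 0-preserving
    sumF-preserving {suc j} f = trans (additive _ _) (+-congˡ (sumF-preserving (f ∘ suc)))

  Tr-isFqLinear : IsFqLinear Tr
  Tr-isFqLinear = record { cong = Tr-cong ; additive = Tr-+ ; homogeneous = Tr-homogeneous }

  sumAll-Tr : ∀ c (f : Carrier → Carrier) → sumAll (λ a → Tr (a * c) * f a) ≈
    sumF {n} (λ t → frobPow (toℕ t) c * sumAll (λ a → frobPow (toℕ t) a * f a))
  sumAll-Tr c f = begin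
    sumAll (λ a → Tr (a * c) * f a)
      ≈⟨ sumF-cong {N} (expand ∘ enum) ⟩
    sumF {N} (λ i → sumF {n} (λ t → term t (enum i)))
      ≈⟨ sumF-comm {N} {n} (λ i t → term t (enum i)) ⟩
    sumF {n} (λ t → sumAll (term t))
      ≈⟨ sumF-cong {n} (λ t → *-distribˡ-sumF {N} (frobPow (toℕ t) c) (λ i → frobPow (toℕ t) (enum i) * f (enum i))) ⟨
    sumF {n} (λ t → frobPow (toℕ t) c * sumAll (λ a → frobPow (toℕ t) a * f a)) ∎
    where
    term : Fin n → Carrier → Carrier
    term t a = frobPow (toℕ t) c * (frobPow (toℕ t) a * f a)
    expand : ∀ a → Tr (a * c) * f a ≈ sumF {n} (λ t → term t a)
    expand a = begin
      Tr (a * c) * f a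
        ≈⟨ *-comm _ _ ⟩
      f a * Tr (a * c)
        ≈⟨ *-distribˡ-sumF {n} (f a) (λ t → frobPow (toℕ t) (a * c)) ⟩
      sumF {n} (λ t → f a * frobPow (toℕ t) (a * c))
        ≈⟨ sumF-cong {n} (λ t → *-congˡ {f a} (frobPow-distrib-* (toℕ t) a c)) ⟩
      sumF {n} (λ t → f a * (frobPow (toℕ t) a * frobPow (toℕ t) c))
        ≈⟨ sumF-cong {n} (λ t → x∙yz≈z∙yx (f a) (frobPow (toℕ t) a) (frobPow (toℕ t) c)) ⟩
      sumF {n} (λ t → term t a) ∎

  2≤N : 2 ≤ N
  2≤N = ℕP.≤-trans 1<q (≡.subst (_≤ N) (ℕP.*-identityʳ q) (ℕP.^-monoʳ-≤ q {{ℕ.>-nonZero 0<q}} {1} {n} (s≤s z≤n)))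

  N∸1≡1+N∸2 : N ∸ 1 ≡ suc (N ∸ 2)
  N∸1≡1+N∸2 = ℕP.+-∸-assoc 1 2≤N

  -- pow a (N ∸ 2) is the inverse of a ≉ 0, and 0 at 0.
  inv₀ : Carrier → Carrier
  inv₀ a = pow a (N ∸ 2)

  inv₀-cong : ∀ {a b} → a ≈ b → inv₀ a ≈ inv₀ b
  inv₀-cong = pow-cong (N ∸ 2)

  *-inv₀ : ∀ a → a * inv₀ a ≈ pow a (N ∸ 1)
  *-inv₀ a = reflexive (≡.cong (pow a) (≡.sym N∸1≡1+N∸2))

  pow-N∸1 : ∀ {a} → ¬ a ≈ 0# → pow a (N ∸ 1) ≈ 1#
  pow-N∸1 {a} a≉0 = *-cancelˡ-≉0 a≉0 (begin
    a * pow a (N ∸ 1)    ≡⟨ ≡.cong (pow a) (ℕP.m+[n∸m]≡n (ℕP.<-≤-trans (s≤s z≤n) 2≤N)) ⟩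
    pow a N              ≈⟨ fermat a ⟩
    a                    ≈⟨ *-identityʳ a ⟨
    a * 1#               ∎)

  powerSum : ℕ → Carrier
  powerSum t = sumAll (λ a → frobPow t a * inv₀ a)

  -- a · a^(N-2) is 1 except at a = 0, so the sum is N · 1 - 1.
  powerSum-0 : powerSum 0 ≈ - 1#
  powerSum-0 = inverseˡ-unique _ _ (begin
    powerSum 0 + 1#                                   ≈⟨ +-cong (sumF-cong {N} (a*inv₀a ∘ enum)) (sym δ-sum) ⟩
    sumAll (λ a → pow a (N ∸ 1)) + sumAll δ          ≈⟨ sumF-distrib-+ {N} _ _ ⟨
    sumAll (λ a → pow a (N ∸ 1) + δ a)               ≈⟨ sumF-cong {N} (pow-N∸1+δ ∘ enum) ⟩
    sumF {N} (λ _ → 1#)                               ≈⟨ sumF-const N 1# ⟩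
    N · 1#                                            ≈⟨ N·1≈0 ⟩
    0#                                                ∎)
    where
    δ : Carrier → Carrier
    δ a = ifZero a then 1# else 0#
    δ-sum : sumAll δ ≈ 1#
    δ-sum = trans (sumAll-concentrated (λ a≈b → ifZero-cong 1# a≈b refl) (λ a → ifZero-≉0 {a} 1# 0#))
                  (ifZero-≈0 1# 0# refl)
    a*inv₀a : ∀ a → frobPow 0 a * inv₀ a ≈ pow a (N ∸ 1)
    a*inv₀a a = trans (*-congʳ (*-identityʳ a)) (*-inv₀ a)
    pow-N∸1+δ : ∀ a → pow a (N ∸ 1) + δ a ≈ 1#
    pow-N∸1+δ a with a ≈? 0#
    ... | yes a≈0 = trans (+-congʳ (trans (pow-cong (N ∸ 1) a≈0) (pow-zeroˡ 0<N∸1))) (+-identityˡ 1#)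
      where
      0<N∸1 : 0 < N ∸ 1
      0<N∸1 = ≡.subst (0 <_) (≡.sym N∸1≡1+N∸2) (s≤s z≤n)
    ... | no  a≉0 = trans (+-congʳ (pow-N∸1 a≉0)) (+-identityʳ 1#)

  -- Substituting a ↦ g a multiplies every term by c = g^(q^t) g^(N-2), and c ≉ 1 once g^(q^t) ≉ g.
  powerSum-vanishes : ∀ t → 1 ≤ t → t < n → powerSum t ≈ 0#
  powerSum-vanishes t 1≤t t<n = a≉b∧az≈bz⇒z≈0 c≉1 (begin
    c * powerSum t                 ≈⟨ *-distribˡ-sumF {N} c (term ∘ enum) ⟩
    sumAll (λ a → c * term a)      ≈⟨ sumF-cong {N} (λ i → sym (term-dilate (enum i))) ⟩
    sumAll (λ a → term (g * a))    ≈⟨ sumAll-permute (dilation g g≉0) term-cong ⟨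
    powerSum t                     ≈⟨ *-identityˡ _ ⟨
    1# * powerSum t                ∎)
    where
    e = q ℕ.^ t
    2≤e : 2 ≤ e
    2≤e = ℕP.≤-trans 1<q (≡.subst (_≤ e) (ℕP.*-identityʳ q) (ℕP.^-monoʳ-≤ q {{ℕ.>-nonZero 0<q}} {1} {t} 1≤t))
    non-fixed : ∃ λ g → ¬ pow g e ≈ g
    non-fixed = ∃-pow-≉ e 2≤e (ℕP.^-monoʳ-< q 1<q t<n)
    g = proj₁ non-fixed
    g^e≉g : ¬ pow g e ≈ g
    g^e≉g = proj₂ non-fixed
    g≉0 : ¬ g ≈ 0#
    g≉0 g≈0 = g^e≉g (trans (pow-cong e g≈0) (trans (pow-zeroˡ (ℕP.<-trans (s≤s z≤n) 2≤e)) (sym g≈0)))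
    term : Carrier → Carrier
    term a = frobPow t a * inv₀ a
    term-cong : ∀ {a b} → a ≈ b → term a ≈ term b
    term-cong a≈b = *-cong (frobPow-cong t a≈b) (inv₀-cong a≈b)
    c = term g
    term-dilate : ∀ a → term (g * a) ≈ c * term a
    term-dilate a = trans (*-cong (frobPow-distrib-* t g a) (pow-distrib-* g a (N ∸ 2))) (interchange _ _ _ _)
    c≉1 : ¬ c ≈ 1#
    c≉1 c≈1 = g^e≉g (begin
      pow g e                      ≈⟨ *-identityʳ _ ⟨
      pow g e * 1#                 ≈⟨ *-congˡ (pow-N∸1 g≉0) ⟨
      pow g e * pow g (N ∸ 1)      ≈⟨ *-congˡ (*-inv₀ g) ⟨
      pow g e * (g * inv₀ g)       ≈⟨ x∙yz≈y∙xz (pow g e) g (inv₀ g) ⟩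
      g * c                        ≈⟨ *-congˡ c≈1 ⟩
      g * 1#                       ≈⟨ *-identityʳ g ⟩
      g                            ∎)

  trace-reproducing : ∀ c → sumAll (λ a → Tr (a * c) * inv₀ a) ≈ - c
  trace-reproducing c = begin
    sumAll (λ a → Tr (a * c) * inv₀ a)                   ≈⟨ sumAll-Tr c inv₀ ⟩
    sumF {n} (term ∘ toℕ)                                ≈⟨ sumF-head {m} (term ∘ toℕ) (λ t → trans (*-congˡ (vanish t)) (zeroʳ _)) ⟩
    term 0                                               ≈⟨ *-cong (*-identityʳ c) powerSum-0 ⟩
    c * - 1#                                             ≈⟨ *-comm c _ ⟩
    - 1# * c                                             ≈⟨ -1*x≈-x c ⟩
    - c                                                  ∎
    where
    term : ℕ → Carrier
    term t = frobPow t c * powerSum t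
    vanish : ∀ (t : Fin m) → powerSum (suc (toℕ t)) ≈ 0#
    vanish t = powerSum-vanishes (suc (toℕ t)) (s≤s z≤n) (s≤s (FinP.toℕ<n t))

  module _ {ℓ : Carrier → Carrier} (L : IsFqLinear ℓ) where
    open IsFqLinear L
    private
      module Tr = IsFqLinear Tr-isFqLinear

    Fq-linear-reproducing : ∀ c → ℓ c ≈ - sumAll (λ a → Tr (a * c) * ℓ (inv₀ a))
    Fq-linear-reproducing c = begin
      ℓ c                                                 ≈⟨ cong (-‿involutive c) ⟨
      ℓ (- - c)                                           ≈⟨ cong (-‿cong (trace-reproducing c)) ⟨
      ℓ (- sumAll (λ a → Tr (a * c) * inv₀ a))            ≈⟨ neg-preserving _ ⟩
      - ℓ (sumAll (λ a → Tr (a * c) * inv₀ a))            ≈⟨ -‿cong (sumF-preserving {N} _) ⟩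
      - sumAll (λ a → ℓ (Tr (a * c) * inv₀ a))            ≈⟨ -‿cong (sumF-cong {N} (λ i → homogeneous _ _ (Tr-InFq _))) ⟩
      - sumAll (λ a → Tr (a * c) * ℓ (inv₀ a))            ∎

    linearised-representation : ∃ λ (λs : Fin n → Carrier) → ∀ c → ℓ c ≈ sumF {n} (λ t → λs t * frobPow (toℕ t) c)
    linearised-representation = λs , representation
      where
      coefficient : ℕ → Carrier
      coefficient t = sumAll (λ a → frobPow t a * ℓ (inv₀ a))
      λs : Fin n → Carrier
      λs t = - coefficient (toℕ t)
      representation : ∀ c → ℓ c ≈ sumF {n} (λ t → λs t * frobPow (toℕ t) c)
      representation c = begin
        ℓ c                                       ≈⟨ Fq-linear-reproducing c ⟩
        - sumAll (λ a → Tr (a * c) * ℓ (inv₀ a))  ≈⟨ -‿cong (sumAll-Tr c (ℓ ∘ inv₀)) ⟩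
        - sumF {n} (term ∘ toℕ)                   ≈⟨ -1*x≈-x _ ⟨
        - 1# * sumF {n} (term ∘ toℕ)              ≈⟨ *-distribˡ-sumF {n} (- 1#) (term ∘ toℕ) ⟩
        sumF {n} (λ t → - 1# * term (toℕ t))      ≈⟨ sumF-cong {n} (λ t → regroup (frobPow (toℕ t) c) (coefficient (toℕ t))) ⟩
        sumF {n} (λ t → λs t * frobPow (toℕ t) c) ∎
        where
        term : ℕ → Carrier
        term t = frobPow t c * coefficient t
        regroup : ∀ x y → - 1# * (x * y) ≈ - y * x
        regroup x y = trans (x∙yz≈xz∙y (- 1#) x y) (*-congʳ (-1*x≈-x y))

    trace-duality : (∀ u → InFq (ℓ u)) → ∃ λ z → ∀ c → Tr (z * c) ≈ ℓ c
    trace-duality ℓ∈Fq = z , duality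
      where
      weighted : Carrier → Carrier
      weighted a = ℓ (inv₀ a) * a
      z = - sumAll weighted
      duality : ∀ c → Tr (z * c) ≈ ℓ c
      duality c = begin
        Tr (z * c)                                  ≈⟨ Tr-cong (-‿distribˡ-* _ c) ⟨
        Tr (- (sumAll weighted * c))                ≈⟨ Tr.neg-preserving _ ⟩
        - Tr (sumAll weighted * c)                  ≈⟨ -‿cong (Tr-cong (*-distribʳ-sumF {N} c (weighted ∘ enum))) ⟩
        - Tr (sumAll (λ a → weighted a * c))        ≈⟨ -‿cong (Tr.sumF-preserving {N} _) ⟩
        - sumAll (λ a → Tr (weighted a * c))        ≈⟨ -‿cong (sumF-cong {N} (pull-out ∘ enum)) ⟩
        - sumAll (λ a → Tr (a * c) * ℓ (inv₀ a))    ≈⟨ Fq-linear-reproducing c ⟨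
        ℓ c                                         ∎
        where
        pull-out : ∀ a → Tr (weighted a * c) ≈ Tr (a * c) * ℓ (inv₀ a)
        pull-out a = trans (Tr-cong (*-assoc _ a c)) (trans (Tr-homogeneous _ _ (ℓ∈Fq (inv₀ a))) (*-comm _ _))

  Tr-scaled-isFqLinear : ∀ {g} → IsFqLinear g → ∀ z → IsFqLinear (λ u → Tr (z * g u))
  Tr-scaled-isFqLinear {g} G z = record
    { cong        = λ x≈y → Tr-cong (*-congˡ (cong x≈y))
    ; additive    = λ x y → trans (Tr-cong (trans (*-congˡ (additive x y)) (distribˡ z _ _))) (Tr-+ _ _)
    ; homogeneous = λ c x c∈Fq → trans (Tr-cong (trans (*-congˡ (homogeneous c x c∈Fq)) (x∙yz≈y∙xz z c (g x))))
                                       (Tr-homogeneous c _ c∈Fq)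
    }
    where open IsFqLinear G

  module _ {h : Carrier → Carrier} (H : IsInvFqLinear h) where
    open IsInvFqLinear H

    h-isFqLinear : IsFqLinear h
    h-isFqLinear = record { cong = cong-h ; additive = additive ; homogeneous = homog }

    -- h is onto, hence one-to-one because the field is finite.
    h-injective : ∀ {x y} → h x ≈ h y → x ≈ y
    h-injective {x} {y} hx≈hy = begin
      x                    ≈⟨ enum-index x ⟨
      enum (index x)       ≡⟨ ≡.cong enum (hᶠ-injective (index-cong h∘enum∘index≈)) ⟩
      enum (index y)       ≈⟨ enum-index y ⟩
      y                    ∎
      where
      h∘enum∘index≈ : h (enum (index x)) ≈ h (enum (index y))
      h∘enum∘index≈ = trans (cong-h (enum-index x)) (trans hx≈hy (sym (cong-h (enum-index y))))
      hᶠ invᶠ : Fin N → Fin N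
      hᶠ i = index (h (enum i))
      invᶠ i = index (inv (enum i))
      hᶠ-invᶠ : ∀ i → hᶠ (invᶠ i) ≡ i
      hᶠ-invᶠ i = enum-inj _ _ (trans (enum-index _) (trans (cong-h (enum-index _)) (inv-r _)))
      invᶠ-injective : Injective _≡_ _≡_ invᶠ
      invᶠ-injective {a} {b} e = ≡.trans (≡.sym (hᶠ-invᶠ a)) (≡.trans (≡.cong hᶠ e) (hᶠ-invᶠ b))
      hᶠ-injective : Injective _≡_ _≡_ hᶠ
      hᶠ-injective {a} {b} e with injective⇒surjective invᶠ invᶠ-injective a | injective⇒surjective invᶠ invᶠ-injective b
      ... | a′ , ≡.refl | b′ , ≡.refl = ≡.cong invᶠ (≡.trans (≡.sym (hᶠ-invᶠ a′)) (≡.trans e (hᶠ-invᶠ b′)))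

    inv-isFqLinear : IsFqLinear inv
    inv-isFqLinear = record
      { cong        = λ {x} {y} x≈y → h-injective (trans (inv-r x) (trans x≈y (sym (inv-r y))))
      ; additive    = λ x y → h-injective (trans (inv-r _) (sym (trans (additive _ _) (+-cong (inv-r x) (inv-r y)))))
      ; homogeneous = λ c x c∈Fq → h-injective (trans (inv-r _) (sym (trans (homog c _ c∈Fq) (*-congˡ (inv-r x)))))
      }

  -- The index shift of σ is undone by Frobenius: (a^(q^(i-1)))^q = a^(q^i), read mod n.
  φc-predMod : ∀ a i → pow (φc a (predMod i)) q ≈ φc a i
  φc-predMod a zero = begin
    pow (frobPow (toℕ (fromℕ m)) a) q   ≡⟨ ≡.cong (λ e → pow (frobPow e a) q) (FinP.toℕ-fromℕ m) ⟩
    pow (frobPow m a) q                 ≈⟨ frobPow-suc m a ⟩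
    frobPow n a                         ≈⟨ frobPow-n a ⟩
    a                                   ≈⟨ *-identityʳ a ⟨
    frobPow 0 a                         ∎
  φc-predMod a (suc i) =
    trans (reflexive (≡.cong (λ e → pow (frobPow e a) q) (FinP.toℕ-inject₁ i))) (frobPow-suc (toℕ i) a)

  scaledOuter : (Carrier → Carrier) → Fin n → Fin n → Carrier × Carrier × Carrier → Carrier
  scaledOuter f i j (a , b , c) = f c * outer a b i j

  scaledOuter-cong : ∀ {f g} → (∀ c → f c ≈ g c) → ∀ T i j → sumL (scaledOuter f i j) T ≈ sumL (scaledOuter g i j) T
  scaledOuter-cong f≈g T i j = sumL-cong T (λ { (a , b , c) → *-congʳ (f≈g c) })

  M-scaledOuter : ∀ T i j → M T i j ≈ sumL (scaledOuter (λ c → c) i j) T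
  M-scaledOuter T i j = sumL-cong T (λ { (a , b , c) → refl })

  M-act : ∀ h T i j → M (act h T) i j ≈ sumL (scaledOuter h i j) T
  M-act h T i j = trans (reflexive (sumL-map _ _ T)) (sumL-cong T (λ { (a , b , c) → refl }))

  zdual-scaledOuter : ∀ z T i j → zdual z T i j ≈ sumL (scaledOuter (λ c → Tr (z * c)) i j) T
  zdual-scaledOuter z T i j = sumL-cong T (λ { (a , b , c) → refl })

  zdual-act : ∀ h z T i j → zdual z (act h T) i j ≈ sumL (scaledOuter (λ c → Tr (z * h c)) i j) T
  zdual-act h z T i j = trans (reflexive (sumL-map _ _ T)) (sumL-cong T (λ { (a , b , c) → refl }))

  σ^-M : ∀ t T i j → σ^ t (M T) i j ≈ sumL (scaledOuter (frobPow t) i j) T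
  σ^-M zero T i j = trans (M-scaledOuter T i j) (scaledOuter-cong (λ c → sym (*-identityʳ c)) T i j)
  σ^-M (suc t) T i j = begin
    pow (σ^ t (M T) (predMod i) (predMod j)) q
      ≈⟨ pow-cong q (σ^-M t T (predMod i) (predMod j)) ⟩
    pow (sumL (scaledOuter (frobPow t) (predMod i) (predMod j)) T) q
      ≈⟨ pow-additive-sumL frobenius-q-additive 0<q _ T ⟩
    sumL (λ x → pow (scaledOuter (frobPow t) (predMod i) (predMod j) x) q) T
      ≈⟨ sumL-cong T (λ { (a , b , c) → frobenius-term a b c }) ⟩
    sumL (scaledOuter (frobPow (suc t)) i j) T ∎
    where
    frobenius-term : ∀ a b c →
      pow (frobPow t c * outer a b (predMod i) (predMod j)) q ≈ frobPow (suc t) c * outer a b i j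
    frobenius-term a b c =
      trans (pow-distrib-* _ _ q) (*-cong (frobPow-suc t c)
        (trans (pow-distrib-* _ _ q) (*-cong (φc-predMod a i) (φc-predMod b j))))

  module _ {h : Carrier → Carrier} (H : IsInvFqLinear h) (T : Tensor) where
    open IsInvFqLinear H using (inv; inv-l)

    M-act∈C̄₃ : InC3bar T (M (act h T))
    M-act∈C̄₃ = λs , expansion
      where
      λs : Fin n → Carrier
      λs = proj₁ (linearised-representation (h-isFqLinear H))
      h≈ : ∀ c → h c ≈ sumF {n} (λ s → λs s * frobPow (toℕ s) c)
      h≈ = proj₂ (linearised-representation (h-isFqLinear H))
      term : Fin n → Fin n → Fin n → Carrier × Carrier × Carrier → Carrier
      term i j s = scaledOuter (frobPow (toℕ s)) i j
      expansion : ∀ i j → M (act h T) i j ≈ sumF {n} (λ s → λs s * σ^ (toℕ s) (M T) i j)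
      expansion i j = begin
        M (act h T) i j                                         ≈⟨ M-act h T i j ⟩
        sumL (scaledOuter h i j) T                              ≈⟨ sumL-cong T (λ { (a , b , c) → expand a b c }) ⟩
        sumL (λ x → sumF {n} (λ s → λs s * term i j s x)) T      ≈⟨ sumL-sumF (λ x s → λs s * term i j s x) T ⟩
        sumF {n} (λ s → sumL (λ x → λs s * term i j s x) T)      ≈⟨ sumF-cong {n} (λ s → *-distribˡ-sumL (λs s) (term i j s) T) ⟨
        sumF {n} (λ s → λs s * sumL (term i j s) T)              ≈⟨ sumF-cong {n} (λ s → *-congˡ {λs s} (σ^-M (toℕ s) T i j)) ⟨
        sumF {n} (λ s → λs s * σ^ (toℕ s) (M T) i j)             ∎
        where
        expand : ∀ a b c → h c * outer a b i j ≈ sumF {n} (λ s → λs s * (frobPow (toℕ s) c * outer a b i j))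
        expand a b c = begin
          h c * outer a b i j
            ≈⟨ *-congʳ (h≈ c) ⟩
          sumF {n} (λ s → λs s * frobPow (toℕ s) c) * outer a b i j
            ≈⟨ *-distribʳ-sumF {n} (outer a b i j) (λ s → λs s * frobPow (toℕ s) c) ⟩
          sumF {n} (λ s → λs s * frobPow (toℕ s) c * outer a b i j)
            ≈⟨ sumF-cong {n} (λ s → *-assoc (λs s) (frobPow (toℕ s) c) (outer a b i j)) ⟩
          sumF {n} (λ s → λs s * (frobPow (toℕ s) c * outer a b i j)) ∎

    C₃-act : SameC3 (act h T) T
    C₃-act = pushforward , pullback
      where
      transfer : ∀ z z′ → (∀ c → Tr (z * h c) ≈ Tr (z′ * c)) → ∀ i j → zdual z (act h T) i j ≈ zdual z′ T i j
      transfer z z′ z≈z′ i j =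
        trans (zdual-act h z T i j) (trans (scaledOuter-cong z≈z′ T i j) (sym (zdual-scaledOuter z′ T i j)))

      pushforward : ∀ z → Σ Carrier λ z′ → ∀ i j → zdual z (act h T) i j ≈ zdual z′ T i j
      pushforward z = z′ , transfer z z′ (λ c → sym (duality c))
        where
        dual : ∃ λ z′ → ∀ c → Tr (z′ * c) ≈ Tr (z * h c)
        dual = trace-duality (Tr-scaled-isFqLinear (h-isFqLinear H) z) (λ u → Tr-InFq (z * h u))
        z′ = proj₁ dual
        duality : ∀ c → Tr (z′ * c) ≈ Tr (z * h c)
        duality = proj₂ dual

      pullback : ∀ z′ → Σ Carrier λ z → ∀ i j → zdual z′ T i j ≈ zdual z (act h T) i j
      pullback z′ = z , λ i j → sym (transfer z z′ (λ c → trans (duality (h c)) (Tr-cong (*-congˡ (inv-l c)))) i j)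
        where
        dual : ∃ λ z → ∀ c → Tr (z * c) ≈ Tr (z′ * inv c)
        dual = trace-duality (Tr-scaled-isFqLinear (inv-isFqLinear H) z′) (λ u → Tr-InFq (z′ * inv u))
        z = proj₁ dual
        duality : ∀ c → Tr (z * c) ≈ Tr (z′ * inv c)
        duality = proj₂ dual

mainTheorem2 : (R : CommutativeRing 0ℓ 0ℓ) (q m : ℕ) →
    IsPrimePower q → IsFiniteField R (q ^ suc m) →
    let open Model R q m in
    (h : Carrier → Carrier) → IsInvFqLinear h →
    (T : Tensor) → NonZero T →
    InC3bar T (M (act h T)) × SameC3 (act h T) T
mainTheorem2 R q m q-primePower F h H T _ = M-act∈C̄₃ H T , C₃-act H T
  where open Galois R q m q-primePower F
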